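{- Let $\alpha\ge1$, $\beta\ge1$ be integers, $\ell=\min\{\alpha,\beta\}$, $u=\max\{\alpha,\beta\}$, $n\ge1$, and $V=(v_0<\dots<v_{n-1})$ a sorted array. For every $x\in V$, the number of comparisons performed by the $(\alpha,\beta)$ Fibonacci search algorithm on input $V,x$ (equivalently, the depth of its implicit $(\alpha,\beta)$ decision tree) is at most $\lceil u/\ell\rceil\cdot\lceil\log_2 n\rceil$.
   Context: Define $g(k)=0$ for $k<0$, $g(0)=1$, $g(k)=g(k-\alpha)+g(k-\beta)$ for $k\ge1$, and $G(k)=\sum_{i=1}^{\ell} g(k+1-i)$. Setting: $x$ equals one of the items of $V$; a comparison "$x\le v_j$?" costs $\alpha$ if true and $\beta$ if false. The $(\alpha,\beta)$ Fibonacci search algorithm: compute $G$ up to $k=\min\{j\ge0: G(j)\ge n\}$; set $z=k-\alpha$, $left=0$, $right=n-1$; while $left<right$: set $index=\min(left+G(z)-1,\,right)$, compare $x\le v_{index}$; if true set $right=index$ and $z=z-\alpha$, otherwise set $left=index+1$ and $z=z-\beta$. On exit the output position is $left$. -}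

module Defs where

open import Level using (Level)
open import Data.Nat as ℕ using (ℕ; zero; suc)
open import Data.Nat.DivMod using (_/_)
open import Data.Integer as ℤ using (ℤ; +_; -[1+_]; _+_; _-_; _⊓_)
open import Data.Integer.Properties using () renaming (_<?_ to _<ℤ?_)
open import Data.Fin using (Fin; fromℕ<)
open import Data.Vec using (Vec; lookup)
open import Data.Maybe using (Maybe; just; nothing; map)
open import Data.List using (List; []; _∷_; map; upTo)
open import Data.Nat.ListAction using (sum)
open import Data.Bool using (Bool; true; false)
open import Relation.Nullary using (yes; no)
open import Relation.Binary using (Tri; tri<; tri≈; tri>)
open import Relation.Binary.Bundles using (StrictTotalOrder)

-- ⌈ m / n ⌉ (ceiling division); value 0 for n = 0 (never used)
ceilDiv : ℕ → ℕ → ℕ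
ceilDiv m zero    = 0
ceilDiv m (suc k) = (m ℕ.+ k) / suc k

-- g(k) with fuel: g(k)=0 for k<0, g(0)=1, g(k)=g(k-α)+g(k-β) for k≥1.
-- Since α,β ≥ 1, fuel ∣k∣+1 suffices for the recursion to bottom out.
gFuel : ℕ → ℕ → ℕ → ℤ → ℕ
gFuel α β _        -[1+ _ ]    = 0
gFuel α β _        (+ zero)    = 1
gFuel α β zero     (+ suc _)   = 0
gFuel α β (suc f) k@(+ suc _) = gFuel α β f (k - + α) ℕ.+ gFuel α β f (k - + β)

g : ℕ → ℕ → ℤ → ℕ
g α β k = gFuel α β (suc ℤ.∣ k ∣) k

G : ℕ → ℕ → ℤ → ℕ
G α β k = sum (Data.List.map (λ j → g α β ((k + + 1) - + suc j)) (upTo (α ℕ.⊓ β)))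

IsStartIndex : ℕ → ℕ → ℕ → ℕ → Set
IsStartIndex α β n k = (n ℕ.≤ G α β (+ k)) Data.Product.× (∀ j → j ℕ.< k → G α β (+ j) ℕ.< n)
  where import Data.Product

toIndex : (n : ℕ) → ℤ → Maybe (Fin n)
toIndex n -[1+ _ ] = nothing
toIndex n (+ i) with i ℕ.<? n
... | yes p = just (fromℕ< p)
... | no _  = nothing

module FibSearch {c ℓ₁ ℓ₂ : Level} (O : StrictTotalOrder c ℓ₁ ℓ₂) where
  open StrictTotalOrder O using (compare; _<_) renaming (Carrier to A)

  leq? : A → A → Bool
  leq? x v with compare x v
  ... | tri< _ _ _ = true
  ... | tri≈ _ _ _ = true
  ... | tri> _ _ _ = false

  -- Returns just (number of comparisons performed) if the loop exits within
  -- the fuel, nothing if fuel runs out or an index outside 0..n-1 is accessed.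
  loop : (α β : ℕ) {n : ℕ} → Vec A n → A → ℕ → (left right z : ℤ) → Maybe ℕ
  loop α β {n} V x fuel left right z with left <ℤ? right
  ... | no _ = just 0
  loop α β {n} V x zero     left right z | yes _ = nothing
  loop α β {n} V x (suc f)  left right z | yes _
    with toIndex n ((left + + G α β z - + 1) ⊓ right)
  ... | nothing = nothing
  ... | just i with leq? x (lookup V i)
  ...   | true  = Data.Maybe.map suc (loop α β V x f left ((left + + G α β z - + 1) ⊓ right) (z - + α))
  ...   | false = Data.Maybe.map suc (loop α β V x f ((left + + G α β z - + 1) ⊓ right + + 1) right (z - + β))

  comparisons : (α β : ℕ) {n : ℕ} → Vec A n → A → (k fuel : ℕ) → Maybe ℕ
  comparisons α β {n} V x k fuel = loop α β V x fuel (+ 0) (+ n - + 1) (+ k - + α)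

  Sorted : {n : ℕ} → Vec A n → Set ℓ₂
  Sorted {n} V = ∀ (i j : Fin n) → i Data.Fin.< j → lookup V i < lookup V j

-- The proof only uses three facts about the window function G, which are derived from
-- its definition first:  G(z) = 0 for z < 0,  G(j) = 1 for 0 ≤ j < ℓ, and the recurrence
-- G(m) = G(m-α) + G(m-β) for m ≥ ℓ.  From these, G is positive and monotone on ℕ,
-- G(m) ≤ 1 for m < α, and G(m+u) ≥ 2·G(m), so G(L·u) ≥ 2^L.  Taking L = ⌈log₂ n⌉ gives a
-- start index k (the least k with G(k) ≥ n) with k ≤ L·u ≤ ℓ·B, where B = ⌈u/ℓ⌉·L.
--
-- For the loop we keep an invariant on the state (left, right, z) and the remaining
-- budget B': the target position lies in [left, right], the interval has at most G(z+α)
-- entries, and z < ℓ·B'.  Probing position left + G(z) - 1 and moving z down by α or β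
-- (both ≥ ℓ) preserves the invariant -- this is exactly the recurrence for G -- while
-- consuming one unit of budget.  Once z < 0 the interval has a single entry and the loop
-- stops, so at most B comparisons are made.
module Submission where

open import Defs
open import Level using (Level)
open import Data.Nat using (ℕ; _≤_; _*_; _⊓_; _⊔_)
open import Data.Nat.Logarithm using (⌈log₂_⌉)
open import Data.Fin using (Fin; toℕ; fromℕ<)
open import Data.Fin.Properties using (toℕ-fromℕ<; toℕ-injective; toℕ<n)
open import Data.Vec using (Vec; lookup)
open import Data.Maybe using (just)
import Data.Maybe as Maybe
open import Data.Bool using (true; false; if_then_else_)
open import Relation.Binary using (tri<; tri≈; tri>)
open import Data.Product using (Σ; ∃; _×_)
open import Relation.Binary.PropositionalEquality using (_≡_)
open import Relation.Binary.Bundles using (StrictTotalOrder)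

open import Data.Nat using (zero; suc; _+_; _^_; _∸_; _<_; z≤n; s≤s; _≤′_; ≤′-refl; ≤′-step; ⌈_/2⌉; ⌊_/2⌋)
open import Data.Nat.Properties
open import Data.Nat.Induction using (<-rec)
open import Data.Nat.DivMod using (_/_; _%_; m≡m%n+[m/n]*n; m%n<n)
open import Data.Nat.Logarithm using (⌈log₂⌈n/2⌉⌉≡⌈log₂n⌉∸1; ⌈log₂⌉-mono-≤)
import Data.Nat.Tactic.RingSolver as ℕ-Solver
open import Data.Integer as ℤ using (ℤ; +_; -[1+_]; +<+; -<+) renaming (_+_ to _+ℤ_; _-_ to _-ℤ_; _<_ to _<ℤ_)
import Data.Integer.Properties as ℤP
import Data.Integer.Tactic.RingSolver as ℤ-Solver
open import Data.List using (applyUpTo; upTo)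
open import Data.List.Properties using (map-upTo)
open import Data.Nat.ListAction using (sum)
open import Data.Product using (_,_; proj₁; proj₂)
open import Data.Sum using (_⊎_; inj₁; inj₂)
open import Data.Empty using (⊥-elim)
open import Function using (_∘_)
open import Algebra.Properties.CommutativeSemigroup +-commutativeSemigroup using () renaming (interchange to +-interchange)
open import Relation.Nullary using (¬_; yes; no)
open import Relation.Binary.PropositionalEquality using (refl; sym; trans; cong; cong₂; subst; subst₂; _≢_; module ≡-Reasoning)

ceilDiv-spec : ∀ a l → 1 ≤ l → a ≤ ceilDiv a l * l
ceilDiv-spec a (suc k) _ = +-cancelʳ-≤ k a (q * suc k) (begin
    a + k                        ≡⟨ m≡m%n+[m/n]*n (a + k) (suc k) ⟩
    (a + k) % suc k + q * suc k  ≤⟨ +-monoˡ-≤ (q * suc k) (≤-pred (m%n<n (a + k) (suc k))) ⟩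
    k + q * suc k                ≡⟨ +-comm k (q * suc k) ⟩
    q * suc k + k                ∎)
  where
  open ≤-Reasoning
  q : ℕ
  q = (a + k) / suc k

n≤2^⌈log₂n⌉ : ∀ n → 1 ≤ n → n ≤ 2 ^ ⌈log₂ n ⌉
n≤2^⌈log₂n⌉ = <-rec _ halve
  where
  halve : ∀ n → (∀ {m} → m < n → 1 ≤ m → m ≤ 2 ^ ⌈log₂ m ⌉) → 1 ≤ n → n ≤ 2 ^ ⌈log₂ n ⌉
  halve 1 _ _ = ≤-refl
  halve n@(suc (suc k)) ih _ = begin
      n                          ≡⟨ sym (⌊n/2⌋+⌈n/2⌉≡n n) ⟩
      ⌊ n /2⌋ + ⌈ n /2⌉          ≤⟨ +-monoˡ-≤ ⌈ n /2⌉ (⌊n/2⌋≤⌈n/2⌉ n) ⟩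
      ⌈ n /2⌉ + ⌈ n /2⌉          ≡⟨ cong (λ h → ⌈ n /2⌉ + h) (sym (+-identityʳ ⌈ n /2⌉)) ⟩
      2 * ⌈ n /2⌉                ≤⟨ *-monoʳ-≤ 2 (ih (⌈n/2⌉<n k) (s≤s z≤n)) ⟩
      2 * 2 ^ ⌈log₂ ⌈ n /2⌉ ⌉    ≡⟨ cong (λ e → 2 ^ suc e) (⌈log₂⌈n/2⌉⌉≡⌈log₂n⌉∸1 n) ⟩
      2 ^ suc (⌈log₂ n ⌉ ∸ 1)    ≡⟨ cong (2 ^_) (m+[n∸m]≡n (⌈log₂⌉-mono-≤ {2} {n} (s≤s (s≤s z≤n)))) ⟩
      2 ^ ⌈log₂ n ⌉              ∎
    where open ≤-Reasoning

minus-decreases : ∀ {m c} → 1 ≤ c → c ≤ m → m ∸ c < m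
minus-decreases {m} {c} 1≤c c≤m = ∸-monoʳ-< {m} {c} {0} 1≤c c≤m

minus-nat : ∀ {m c} → c ≤ m → + m -ℤ + c ≡ + (m ∸ c)
minus-nat {m} {c} c≤m = trans (ℤP.m-n≡m⊖n m c) (ℤP.⊖-≥ c≤m)

minus-cases : ∀ m c → (c ≤ m × + m -ℤ + c ≡ + (m ∸ c)) ⊎ (∃ λ r → + m -ℤ + c ≡ -[1+ r ])
minus-cases m c with c ≤? m
... | yes c≤m = inj₁ (c≤m , minus-nat c≤m)
... | no  c≰m = inj₂ (c ∸ suc m , trans (ℤP.m-n≡m⊖n m c)
                        (trans (ℤP.⊖-< m<c) (cong (λ d → ℤ.- (+ d)) (+-∸-assoc 1 m<c))))
  where
  m<c : m < c
  m<c = ≰⇒> c≰m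

minus-below : ∀ {p c X} → p < c + X → + p -ℤ + c <ℤ + X
minus-below {p} {c} {X} p<c+X with minus-cases p c
... | inj₂ (_ , eq) rewrite eq = -<+
... | inj₁ (c≤p , eq) rewrite eq =
  +<+ (+-cancelˡ-< c (p ∸ c) X (subst (_< c + X) (sym (m+[n∸m]≡n c≤p)) p<c+X))

window-shift : ∀ (k i : ℤ) → (k +ℤ + 1) -ℤ (+ 1 +ℤ i) ≡ k -ℤ i
window-shift = ℤ-Solver.solve-∀

probe-shift : ∀ (a q : ℤ) → a +ℤ (+ 1 +ℤ q) -ℤ + 1 ≡ a +ℤ q
probe-shift = ℤ-Solver.solve-∀

minus-plus : ∀ (p c : ℤ) → p -ℤ c +ℤ c ≡ p
minus-plus = ℤ-Solver.solve-∀

plus-minus : ∀ (p c : ℤ) → p +ℤ c -ℤ c ≡ p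
plus-minus = ℤ-Solver.solve-∀

plus-minus-swap : ∀ (p c d : ℤ) → p +ℤ c -ℤ d ≡ p -ℤ d +ℤ c
plus-minus-swap = ℤ-Solver.solve-∀

minus-swap : ∀ (a b c : ℤ) → a -ℤ b -ℤ c ≡ a -ℤ c -ℤ b
minus-swap = ℤ-Solver.solve-∀

regroup : ∀ a q X → a + (suc q + X) ≡ a + q + 1 + X
regroup = ℕ-Solver.solve-∀

below-own-fuel : ∀ k → k <ℤ + suc ℤ.∣ k ∣
below-own-fuel -[1+ _ ] = -<+
below-own-fuel (+ m)    = +<+ (n<1+n m)

sum-applyUpTo-cong : ∀ {f h} l → (∀ i → i < l → f i ≡ h i) → sum (applyUpTo f l) ≡ sum (applyUpTo h l)
sum-applyUpTo-cong zero    _  = refl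
sum-applyUpTo-cong (suc l) eq = cong₂ _+_ (eq 0 (s≤s z≤n)) (sum-applyUpTo-cong l (λ i i<l → eq (suc i) (s≤s i<l)))

sum-applyUpTo-+ : ∀ f h l → sum (applyUpTo (λ i → f i + h i) l) ≡ sum (applyUpTo f l) + sum (applyUpTo h l)
sum-applyUpTo-+ f h zero    = refl
sum-applyUpTo-+ f h (suc l) = trans (cong (λ s → f 0 + h 0 + s) (sum-applyUpTo-+ (λ i → f (suc i)) (λ i → h (suc i)) l))
                                    (+-interchange (f 0) (h 0) _ _)

sum-applyUpTo-zero : ∀ f l → (∀ i → f i ≡ 0) → sum (applyUpTo f l) ≡ 0
sum-applyUpTo-zero f zero    _  = refl
sum-applyUpTo-zero f (suc l) f≡0 rewrite f≡0 0 = sum-applyUpTo-zero (λ i → f (suc i)) l (λ i → f≡0 (suc i))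

sum-applyUpTo-single : ∀ f l j → j < l → (∀ i → i ≢ j → f i ≡ 0) → sum (applyUpTo f l) ≡ f j
sum-applyUpTo-single f (suc l) zero _ others
  rewrite sum-applyUpTo-zero (λ i → f (suc i)) l (λ i → others (suc i) (λ ())) = +-identityʳ (f 0)
sum-applyUpTo-single f (suc l) (suc j) (s≤s j<l) others
  rewrite others 0 (λ ()) = sum-applyUpTo-single (λ i → f (suc i)) l j j<l (λ i i≢j → others (suc i) (i≢j ∘ suc-injective))

-- The window function G

module Window (α β : ℕ) (1≤α : 1 ≤ α) (1≤β : 1 ≤ β) where

  ℓ u : ℕ
  ℓ = α ⊓ β
  u = α ⊔ β

  1≤ℓ : 1 ≤ ℓ
  1≤ℓ = ⊓-glb 1≤α 1≤β

  ℓ≤α : ℓ ≤ α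
  ℓ≤α = m⊓n≤m α β

  ℓ≤β : ℓ ≤ β
  ℓ≤β = m⊓n≤n α β

  gFuel-irrelevant : ∀ f f' k → k <ℤ + f → k <ℤ + f' → gFuel α β f k ≡ gFuel α β f' k
  gFuel-irrelevant _       _        -[1+ _ ]  _           _            = refl
  gFuel-irrelevant _       _        (+ zero)  _           _            = refl
  gFuel-irrelevant zero    _        (+ suc _) (+<+ ())    _
  gFuel-irrelevant (suc _) zero     (+ suc _) _           (+<+ ())
  gFuel-irrelevant (suc f) (suc f') (+ suc m) (+<+ m<f) (+<+ m<f') =
    cong₂ _+_ (gFuel-irrelevant f f' _ (lower 1≤α m<f) (lower 1≤α m<f'))
              (gFuel-irrelevant f f' _ (lower 1≤β m<f) (lower 1≤β m<f'))
    where
    lower : ∀ {c F} → 1 ≤ c → suc m < suc F → + suc m -ℤ + c <ℤ + F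
    lower {c} 1≤c (s≤s m<F) = minus-below {c = c} (+-mono-≤ 1≤c m<F)

  g-recurrence : ∀ {k} → + 0 <ℤ k → g α β k ≡ g α β (k -ℤ + α) + g α β (k -ℤ + β)
  g-recurrence {+ zero} (+<+ ())
  g-recurrence {+ suc m} _ = cong₂ _+_ (to-g α 1≤α) (to-g β 1≤β)
    where
    to-g : ∀ c → 1 ≤ c → gFuel α β (suc m) (+ suc m -ℤ + c) ≡ g α β (+ suc m -ℤ + c)
    to-g c 1≤c = gFuel-irrelevant _ _ _ (minus-below {c = c} (m<n+m (suc m) 1≤c)) (below-own-fuel _)

  -- g vanishes strictly between 0 and ℓ: both recursive arguments are negative there.
  g-vanishes : ∀ m → 1 ≤ m → m < ℓ → g α β (+ m) ≡ 0
  g-vanishes m@(suc _) 0<m m<ℓ rewrite g-recurrence {+ m} (+<+ 0<m)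
    with minus-cases m α | minus-cases m β
  ... | inj₁ (α≤m , _) | _ = ⊥-elim (<-irrefl refl (<-≤-trans m<ℓ (≤-trans ℓ≤α α≤m)))
  ... | inj₂ _ | inj₁ (β≤m , _) = ⊥-elim (<-irrefl refl (<-≤-trans m<ℓ (≤-trans ℓ≤β β≤m)))
  ... | inj₂ (_ , eqα) | inj₂ (_ , eqβ) rewrite eqα | eqβ = refl

  G-window : ∀ k → G α β k ≡ sum (applyUpTo (λ i → g α β (k -ℤ + i)) ℓ)
  G-window k = trans (cong sum (map-upTo _ ℓ))
    (sum-applyUpTo-cong ℓ (λ i _ → cong (g α β) (window-shift k (+ i))))

  G-negative : ∀ r → G α β -[1+ r ] ≡ 0
  G-negative r = trans (G-window -[1+ r ])
    (sum-applyUpTo-zero _ ℓ (λ i → cong (g α β) (ℤP.neg-minus-pos r i)))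

  G-initial : ∀ j → j < ℓ → G α β (+ j) ≡ 1
  G-initial j j<ℓ = trans (G-window (+ j))
    (trans (sum-applyUpTo-single _ ℓ j j<ℓ others) (cong (g α β) (ℤP.+-inverseʳ (+ j))))
    where
    others : ∀ i → i ≢ j → g α β (+ j -ℤ + i) ≡ 0
    others i i≢j with minus-cases j i
    ... | inj₂ (_ , eq) rewrite eq = refl
    ... | inj₁ (i≤j , eq) rewrite eq =
      g-vanishes (j ∸ i) (m<n⇒0<n∸m (≤∧≢⇒< i≤j i≢j)) (≤-<-trans (m∸n≤m j i) j<ℓ)

  G-recurrence : ∀ m → ℓ ≤ m → G α β (+ m) ≡ G α β (+ m -ℤ + α) + G α β (+ m -ℤ + β)
  G-recurrence m ℓ≤m = begin
    G α β (+ m)                                            ≡⟨ G-window (+ m) ⟩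
    sum (applyUpTo (λ i → g α β (+ m -ℤ + i)) ℓ)           ≡⟨ sum-applyUpTo-cong ℓ termwise ⟩
    sum (applyUpTo (λ i → gα i + gβ i) ℓ)                  ≡⟨ sum-applyUpTo-+ gα gβ ℓ ⟩
    sum (applyUpTo gα ℓ) + sum (applyUpTo gβ ℓ)
      ≡⟨ sym (cong₂ _+_ (G-window (+ m -ℤ + α)) (G-window (+ m -ℤ + β))) ⟩
    G α β (+ m -ℤ + α) + G α β (+ m -ℤ + β)                ∎
    where
    open ≡-Reasoning
    gα gβ : ℕ → ℕ
    gα i = g α β (+ m -ℤ + α -ℤ + i)
    gβ i = g α β (+ m -ℤ + β -ℤ + i)
    -- each term g(m - i), i < ℓ ≤ m, has a positive argument and so splits by the recurrence for g
    termwise : ∀ i → i < ℓ → g α β (+ m -ℤ + i) ≡ gα i + gβ i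
    termwise i i<ℓ = trans (g-recurrence positive)
      (cong₂ _+_ (cong (g α β) (minus-swap (+ m) (+ i) (+ α))) (cong (g α β) (minus-swap (+ m) (+ i) (+ β))))
      where
      i<m : i < m
      i<m = <-≤-trans i<ℓ ℓ≤m
      positive : + 0 <ℤ + m -ℤ + i
      positive = subst (+ 0 <ℤ_) (sym (minus-nat (<⇒≤ i<m))) (+<+ (m<n⇒0<n∸m i<m))

  -- G(m - ℓ) ≤ G(m) for m ≥ ℓ: as ℓ ∈ {α, β}, G(m - ℓ) is a summand of the recurrence.
  G-ℓ-back : ∀ m → ℓ ≤ m → G α β (+ (m ∸ ℓ)) ≤ G α β (+ m)
  G-ℓ-back m ℓ≤m with ⊓-sel α β
  ... | inj₁ ℓ≡α = subst (λ c → G α β (+ (m ∸ c)) ≤ G α β (+ m)) (sym ℓ≡α)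
      (≤-trans (≤-reflexive (cong (G α β) (sym (minus-nat (subst (_≤ m) ℓ≡α ℓ≤m)))))
        (≤-trans (m≤m+n _ _) (≤-reflexive (sym (G-recurrence m ℓ≤m)))))
  ... | inj₂ ℓ≡β = subst (λ c → G α β (+ (m ∸ c)) ≤ G α β (+ m)) (sym ℓ≡β)
      (≤-trans (≤-reflexive (cong (G α β) (sym (minus-nat (subst (_≤ m) ℓ≡β ℓ≤m)))))
        (≤-trans (m≤n+m _ _) (≤-reflexive (sym (G-recurrence m ℓ≤m)))))

  G-positive : ∀ m → 1 ≤ G α β (+ m)
  G-positive = <-rec _ positive
    where
    positive : ∀ m → (∀ {r} → r < m → 1 ≤ G α β (+ r)) → 1 ≤ G α β (+ m)
    positive m ih with m <? ℓ
    ... | yes m<ℓ = ≤-reflexive (sym (G-initial m m<ℓ))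
    ... | no  m≮ℓ = ≤-trans (ih (minus-decreases 1≤ℓ ℓ≤m)) (G-ℓ-back m ℓ≤m)
      where
      ℓ≤m : ℓ ≤ m
      ℓ≤m = ≮⇒≥ m≮ℓ

  -- Below α the window holds at most one entry (the α-summand of the recurrence is G(negative) = 0).
  G-below-α : ∀ m → m < α → G α β (+ m) ≤ 1
  G-below-α = <-rec _ atMostOne
    where
    atMostOne : ∀ m → (∀ {r} → r < m → r < α → G α β (+ r) ≤ 1) → m < α → G α β (+ m) ≤ 1
    atMostOne m ih m<α with m <? ℓ
    ... | yes m<ℓ = ≤-reflexive (G-initial m m<ℓ)
    ... | no  m≮ℓ rewrite G-recurrence m (≮⇒≥ m≮ℓ) with minus-cases m α | minus-cases m β
    ... | inj₁ (α≤m , _) | _ = ⊥-elim (<-irrefl refl (<-≤-trans m<α α≤m))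
    ... | inj₂ (r , eqα) | inj₂ (s , eqβ) rewrite eqα | eqβ | G-negative r | G-negative s = z≤n
    ... | inj₂ (r , eqα) | inj₁ (β≤m , eqβ) rewrite eqα | eqβ | G-negative r =
      ih (minus-decreases 1≤β β≤m) (≤-<-trans (m∸n≤m m β) m<α)

  G-window-of-negative : ∀ r → G α β (-[1+ r ] +ℤ + α) ≤ 1
  G-window-of-negative r with -[1+ r ] +ℤ + α | ℤP.+-monoˡ-< (+ α) (-<+ {r} {0})
  ... | -[1+ s ] | _         rewrite G-negative s = z≤n
  ... | + m      | +<+ m<α = G-below-α m m<α

  G-step : ∀ m → G α β (+ m) ≤ G α β (+ suc m)
  G-step = <-rec _ step
    where
    step : ∀ m → (∀ {r} → r < m → G α β (+ r) ≤ G α β (+ suc r)) → G α β (+ m) ≤ G α β (+ suc m)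
    step m ih with m <? ℓ
    ... | yes m<ℓ = ≤-trans (≤-reflexive (G-initial m m<ℓ)) (G-positive (suc m))
    ... | no  m≮ℓ = begin
        G α β (+ m)                                        ≡⟨ G-recurrence m ℓ≤m ⟩
        G α β (+ m -ℤ + α) + G α β (+ m -ℤ + β)            ≤⟨ +-mono-≤ (shifted α 1≤α) (shifted β 1≤β) ⟩
        G α β (+ suc m -ℤ + α) + G α β (+ suc m -ℤ + β)    ≡⟨ sym (G-recurrence (suc m) (m≤n⇒m≤1+n ℓ≤m)) ⟩
        G α β (+ suc m)                                    ∎
      where
      open ≤-Reasoning
      ℓ≤m : ℓ ≤ m
      ℓ≤m = ≮⇒≥ m≮ℓ
      shifted : ∀ c → 1 ≤ c → G α β (+ m -ℤ + c) ≤ G α β (+ suc m -ℤ + c)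
      shifted c 1≤c with minus-cases m c
      ... | inj₂ (r , eq) rewrite eq | G-negative r = z≤n
      ... | inj₁ (c≤m , eq) rewrite eq | minus-nat {suc m} {c} (m≤n⇒m≤1+n c≤m) | +-∸-assoc 1 c≤m =
        ih (minus-decreases 1≤c c≤m)

  G-mono : ∀ {m m'} → m ≤ m' → G α β (+ m) ≤ G α β (+ m')
  G-mono {m} m≤m' = along (≤⇒≤′ m≤m')
    where
    along : ∀ {m'} → m ≤′ m' → G α β (+ m) ≤ G α β (+ m')
    along ≤′-refl       = ≤-refl
    along (≤′-step m≤′) = ≤-trans (along m≤′) (G-step _)

  doubling-via : ∀ m c d → d ≤ c →
    G α β (+ (m + c)) ≡ G α β (+ (m + c) -ℤ + c) + G α β (+ (m + c) -ℤ + d) →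
    2 * G α β (+ m) ≤ G α β (+ (m + c))
  doubling-via m c d d≤c recurrence = begin
    2 * G α β (+ m)                                    ≡⟨ cong (λ s → G α β (+ m) + s) (+-identityʳ _) ⟩
    G α β (+ m) + G α β (+ m)                          ≤⟨ +-monoʳ-≤ (G α β (+ m)) (G-mono (m≤m+n m (c ∸ d))) ⟩
    G α β (+ m) + G α β (+ (m + (c ∸ d)))              ≡⟨ cong₂ (λ a b → G α β a + G α β b) back-c back-d ⟩
    G α β (+ (m + c) -ℤ + c) + G α β (+ (m + c) -ℤ + d) ≡⟨ sym recurrence ⟩
    G α β (+ (m + c))                                  ∎
    where
    open ≤-Reasoning
    back-c : + m ≡ + (m + c) -ℤ + c
    back-c = sym (trans (minus-nat (m≤n+m c m)) (cong +_ (m+n∸n≡m m c)))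
    back-d : + (m + (c ∸ d)) ≡ + (m + c) -ℤ + d
    back-d = sym (trans (minus-nat (≤-trans d≤c (m≤n+m c m))) (cong +_ (+-∸-assoc m d≤c)))

  G-doubling : ∀ m → 2 * G α β (+ m) ≤ G α β (+ (m + u))
  G-doubling m with ⊔-sel α β
  ... | inj₁ u≡α = subst (λ v → 2 * G α β (+ m) ≤ G α β (+ (m + v))) (sym u≡α)
      (doubling-via m α β (subst (β ≤_) u≡α (m≤n⊔m α β))
        (G-recurrence (m + α) (≤-trans ℓ≤α (m≤n+m α m))))
  ... | inj₂ u≡β = subst (λ v → 2 * G α β (+ m) ≤ G α β (+ (m + v))) (sym u≡β)
      (doubling-via m β α (subst (α ≤_) u≡β (m≤m⊔n α β))
        (trans (G-recurrence (m + β) (≤-trans ℓ≤β (m≤n+m β m))) (+-comm (G α β (+ (m + β) -ℤ + α)) _)))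

  G-powers : ∀ L → 2 ^ L ≤ G α β (+ (L * u))
  G-powers zero    = ≤-reflexive (sym (G-initial 0 1≤ℓ))
  G-powers (suc L) = begin
    2 * 2 ^ L                 ≤⟨ *-monoʳ-≤ 2 (G-powers L) ⟩
    2 * G α β (+ (L * u))     ≤⟨ G-doubling (L * u) ⟩
    G α β (+ (L * u + u))     ≡⟨ cong (λ e → G α β (+ e)) (+-comm (L * u) u) ⟩
    G α β (+ (suc L * u))     ∎
    where open ≤-Reasoning

  least-start : ∀ n J → n ≤ G α β (+ J) → Σ ℕ λ k → IsStartIndex α β n k × k ≤ J
  least-start n zero    n≤G = 0 , (n≤G , λ _ ()) , z≤n
  least-start n (suc J) n≤G with n ≤? G α β (+ J)
  ... | yes n≤G′ = let (k , start , k≤J) = least-start n J n≤G′ in k , start , m≤n⇒m≤1+n k≤J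
  ... | no  n≰G′ = suc J , (n≤G , λ j j<1+J → ≤-<-trans (G-mono (≤-pred j<1+J)) (≰⇒> n≰G′)) , ≤-refl

-- The search loop

toIndex-in-range : ∀ n i → i < n → ∃ λ j → toIndex n (+ i) ≡ just j × toℕ j ≡ i
toIndex-in-range n i i<n with i <? n
... | yes i<n′ = fromℕ< i<n′ , refl , toℕ-fromℕ< i<n′
... | no  i≮n  = ⊥-elim (i≮n i<n)

count-comparison : ∀ {B r} → (Σ ℕ λ m → r ≡ just m × m ≤ B) →
                   Σ ℕ λ m → Maybe.map suc r ≡ just m × m ≤ suc B
count-comparison (m , r≡m , m≤B) = suc m , cong (Maybe.map suc) r≡m , s≤s m≤B

module Search {c ℓ₁ ℓ₂ : Level} (O : StrictTotalOrder c ℓ₁ ℓ₂) (α β : ℕ) (1≤α : 1 ≤ α) (1≤β : 1 ≤ β) where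
  open StrictTotalOrder O using (compare; _≈_; irrefl; <-respʳ-≈; <-respˡ-≈; module Eq)
    renaming (Carrier to A; _<_ to _≺_; trans to ≺-trans)
  open FibSearch O
  open Window α β 1≤α 1≤β

  leq?-true : ∀ a v → leq? a v ≡ true → ¬ (v ≺ a)
  leq?-true a v answer with compare a v
  ... | tri< _ _ v⊀a = v⊀a
  ... | tri≈ _ _ v⊀a = v⊀a
  leq?-true a v () | tri> _ _ _

  leq?-false : ∀ a v → leq? a v ≡ false → v ≺ a
  leq?-false a v answer with compare a v
  leq?-false a v () | tri< _ _ _
  leq?-false a v () | tri≈ _ _ _
  ... | tri> _ _ v≺a = v≺a

  probe : ℤ → ℤ → ℤ → ℤ
  probe left right z = (left +ℤ + G α β z -ℤ + 1) ℤ.⊓ right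

  probe-value : ∀ a b z q → G α β z ≡ suc q → probe (+ a) (+ b) z ≡ + ((a + q) ⊓ b)
  probe-value a b z q Gz≡ =
    cong (ℤ._⊓ + b) (trans (cong (λ w → + a +ℤ + w -ℤ + 1) Gz≡) (probe-shift (+ a) (+ q)))

  module _ {n : ℕ} (V : Vec A n) (sorted : Sorted V) (x : A) (t : Fin n) (x≈vₜ : x ≈ lookup V t) where

    1≤n : 1 ≤ n
    1≤n = ≤-trans (s≤s z≤n) (toℕ<n t)

    below-target : ∀ i → lookup V i ≺ x → toℕ i < toℕ t
    below-target i vᵢ≺x with toℕ i <? toℕ t
    ... | yes i<t = i<t
    ... | no  i≮t with m≤n⇒m<n∨m≡n (≮⇒≥ i≮t)
    ...   | inj₁ t<i = ⊥-elim (irrefl Eq.refl (≺-trans (<-respˡ-≈ (Eq.sym x≈vₜ) (sorted t i t<i)) vᵢ≺x))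
    ...   | inj₂ t≡i with toℕ-injective t≡i
    ...     | refl = ⊥-elim (irrefl (Eq.sym x≈vₜ) vᵢ≺x)

    not-below-target : ∀ i → ¬ (lookup V i ≺ x) → toℕ t ≤ toℕ i
    not-below-target i vᵢ⊀x with toℕ t ≤? toℕ i
    ... | yes t≤i = t≤i
    ... | no  t≰i = ⊥-elim (vᵢ⊀x (<-respʳ-≈ (Eq.sym x≈vₜ) (sorted i t (≰⇒> t≰i))))

    loop-exit : ∀ f a b z → ¬ a < b → loop α β V x f (+ a) (+ b) z ≡ just 0
    loop-exit f a b z a≮b with + a ℤP.<? + b
    ... | yes a<b = ⊥-elim (a≮b (ℤP.drop‿+<+ a<b))
    ... | no  _   = refl

    loop-step : ∀ f a b z i → a < b → toIndex n (probe (+ a) (+ b) z) ≡ just i →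
      loop α β V x (suc f) (+ a) (+ b) z ≡
        Maybe.map suc (if leq? x (lookup V i)
                         then loop α β V x f (+ a) (probe (+ a) (+ b) z) (z -ℤ + α)
                         else loop α β V x f (probe (+ a) (+ b) z +ℤ + 1) (+ b) (z -ℤ + β))
    loop-step f a b z i a<b index≡ with + a ℤP.<? + b
    ... | no a≮b = ⊥-elim (a≮b (+<+ a<b))
    ... | yes _ rewrite index≡ with leq? x (lookup V i)
    ...   | true  = refl
    ...   | false = refl

    record Invariant (B a b : ℕ) (z : ℤ) : Set where
      field
        left≤t    : a ≤ toℕ t
        t≤right   : toℕ t ≤ b
        right<n   : b < n
        fits      : suc b ≤ a + G α β (z +ℤ + α)
        in-budget : z <ℤ + (ℓ * B)

    WithinBudget : (B a b : ℕ) (z : ℤ) → Set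
    WithinBudget B a b z = Σ ℕ λ m → loop α β V x B (+ a) (+ b) z ≡ just m × m ≤ B

    budget-step : ∀ p B c → ℓ ≤ c → + p <ℤ + (ℓ * suc B) → + p -ℤ + c <ℤ + (ℓ * B)
    budget-step p B c ℓ≤c (+<+ p<ℓ[1+B]) = minus-below {c = c} (<-≤-trans p<ℓ[1+B] (begin
      ℓ * suc B  ≡⟨ *-suc ℓ B ⟩
      ℓ + ℓ * B  ≤⟨ +-monoˡ-≤ (ℓ * B) ℓ≤c ⟩
      c + ℓ * B  ∎))
      where open ≤-Reasoning

    -- Answer "x ≤ v_idx": the target is in [a, idx], whose length is at most G(z) = q + 1.
    keep-left : ∀ {B a b p q} → Invariant (suc B) a b (+ p) → G α β (+ p) ≡ suc q →
      toℕ t ≤ (a + q) ⊓ b → Invariant B a ((a + q) ⊓ b) (+ p -ℤ + α)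
    keep-left {B} {a} {b} {p} {q} inv Gp≡ t≤idx = record
      { left≤t    = left≤t
      ; t≤right   = t≤idx
      ; right<n   = ≤-<-trans (m⊓n≤n (a + q) b) right<n
      ; fits      = begin
          suc ((a + q) ⊓ b)             ≤⟨ s≤s (m⊓n≤m (a + q) b) ⟩
          suc (a + q)                   ≡⟨ sym (+-suc a q) ⟩
          a + suc q                     ≡⟨ cong (λ w → a + w) (sym Gp≡) ⟩
          a + G α β (+ p)               ≡⟨ cong (λ w → a + G α β w) (sym (minus-plus (+ p) (+ α))) ⟩
          a + G α β (+ p -ℤ + α +ℤ + α) ∎
      ; in-budget = budget-step p B α ℓ≤α in-budget
      }
      where
      open Invariant inv
      open ≤-Reasoning

    -- Answer "x > v_idx": the target is in [idx + 1, b].  Since idx < t ≤ b the probe was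
    -- a + q, and the recurrence G(p + α) = G(p) + G(p - β + α) re-establishes the window.
    keep-right : ∀ {B a b p q} → Invariant (suc B) a b (+ p) → G α β (+ p) ≡ suc q →
      (a + q) ⊓ b < toℕ t → Invariant B ((a + q) ⊓ b + 1) b (+ p -ℤ + β)
    keep-right {B} {a} {b} {p} {q} inv Gp≡ idx<t = record
      { left≤t    = subst (_≤ toℕ t) (+-comm 1 ((a + q) ⊓ b)) idx<t
      ; t≤right   = t≤right
      ; right<n   = right<n
      ; fits      = begin
          suc b                    ≤⟨ fits ⟩
          a + G α β (+ (p + α))    ≡⟨ cong (λ w → a + w) window-splits ⟩
          a + (suc q + rest)       ≡⟨ regroup a q rest ⟩
          a + q + 1 + rest         ≡⟨ cong (λ i → i + 1 + rest) (sym idx≡a+q) ⟩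
          (a + q) ⊓ b + 1 + rest   ∎
      ; in-budget = budget-step p B β ℓ≤β in-budget
      }
      where
      open Invariant inv
      open ≤-Reasoning
      rest : ℕ
      rest = G α β (+ p -ℤ + β +ℤ + α)
      window-splits : G α β (+ (p + α)) ≡ suc q + rest
      window-splits = trans (G-recurrence (p + α) (≤-trans ℓ≤α (m≤n+m α p)))
        (cong₂ _+_ (trans (cong (G α β) (plus-minus (+ p) (+ α))) Gp≡)
                   (cong (G α β) (plus-minus-swap (+ p) (+ α) (+ β))))
      idx≡a+q : (a + q) ⊓ b ≡ a + q
      idx≡a+q with ⊓-sel (a + q) b
      ... | inj₁ idx≡a+q = idx≡a+q
      ... | inj₂ idx≡b   = ⊥-elim (<⇒≱ idx<t (subst (toℕ t ≤_) (sym idx≡b) t≤right))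

    probe-step : ∀ B a b p → a < b → Invariant (suc B) a b (+ p) →
      (∀ a′ b′ z′ → Invariant B a′ b′ z′ → WithinBudget B a′ b′ z′) → WithinBudget (suc B) a b (+ p)
    probe-step B a b p a<b inv within-B with m≤n⇒∃[o]m+o≡n (G-positive p)
    ... | q , 1+q≡Gp
      with toIndex-in-range n ((a + q) ⊓ b) (≤-<-trans (m⊓n≤n (a + q) b) (Invariant.right<n inv))
    ... | i , index≡ , i≡idx
      rewrite loop-step B a b (+ p) i a<b (trans (cong (toIndex n) (probe-value a b (+ p) q (sym 1+q≡Gp))) index≡)
            | probe-value a b (+ p) q (sym 1+q≡Gp)
      with leq? x (lookup V i) in answer
    ... | true  = count-comparison (within-B _ _ _ (keep-left inv (sym 1+q≡Gp)
                    (subst (toℕ t ≤_) i≡idx (not-below-target i (leq?-true x (lookup V i) answer)))))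
    ... | false = count-comparison (within-B _ _ _ (keep-right inv (sym 1+q≡Gp)
                    (subst (_< toℕ t) i≡idx (below-target i (leq?-false x (lookup V i) answer)))))

    loop-within-budget : ∀ B a b z → Invariant B a b z → WithinBudget B a b z
    loop-within-budget B a b z inv with b ≤? a
    ... | yes b≤a = 0 , loop-exit B a b z (λ a<b → <⇒≱ a<b b≤a) , z≤n
    ... | no  b≰a with ≰⇒> b≰a
    loop-within-budget B a b -[1+ r ] inv | no _ | a<b =
      -- a negative z leaves room for a single entry only
      ⊥-elim (<⇒≱ a<b (≤-pred (≤-trans (Invariant.fits inv)
        (≤-trans (+-monoʳ-≤ a (G-window-of-negative r)) (≤-reflexive (+-comm a 1))))))
    loop-within-budget zero a b (+ p) inv | no _ | a<b =
      -- the budget ℓ·0 is exhausted while z ≥ 0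
      ⊥-elim (n≮0 (subst (p <_) (*-zeroʳ ℓ) (ℤP.drop‿+<+ (Invariant.in-budget inv))))
    loop-within-budget (suc B) a b (+ p) inv | no _ | a<b =
      probe-step B a b p a<b inv (loop-within-budget B)

    search-within-budget : ∀ B k → k < α + ℓ * B → n ≤ G α β (+ k) →
      Σ ℕ λ m → comparisons α β V x k B ≡ just m × m ≤ B
    search-within-budget B k k<α+ℓB n≤Gk rewrite minus-nat {n} {1} 1≤n =
      loop-within-budget B 0 (n ∸ 1) (+ k -ℤ + α) (record
        { left≤t    = z≤n
        ; t≤right   = <⇒≤pred (toℕ<n t)
        ; right<n   = minus-decreases {n} {1} ≤-refl 1≤n
        ; fits      = subst₂ _≤_ (sym (m+[n∸m]≡n 1≤n)) (cong (G α β) (sym (minus-plus (+ k) (+ α)))) n≤Gk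
        ; in-budget = minus-below {c = α} k<α+ℓB
        })

budget-rearrange : ∀ L c l → L * (c * l) ≡ l * (c * L)
budget-rearrange = ℕ-Solver.solve-∀

corollary1 : ∀ {c ℓ₁ ℓ₂ : Level} (O : StrictTotalOrder c ℓ₁ ℓ₂) (α β n : ℕ) → 1 ≤ α → 1 ≤ β → 1 ≤ n →
    (V : Vec (StrictTotalOrder.Carrier O) n) → FibSearch.Sorted O V →
    (x : StrictTotalOrder.Carrier O) → (∃ λ (i : Fin n) → StrictTotalOrder._≈_ O x (lookup V i)) →
    Σ ℕ λ k → IsStartIndex α β n k ×
      (Σ ℕ λ fuel → Σ ℕ λ m → (FibSearch.comparisons O α β V x k fuel ≡ just m) ×
        (m ≤ ceilDiv (α ⊔ β) (α ⊓ β) * ⌈log₂ n ⌉))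
corollary1 O α β n 1≤α 1≤β 1≤n V sorted x (t , x≈vₜ) =
  k , start , B , Search.search-within-budget O α β 1≤α 1≤β V sorted x t x≈vₜ B k k<α+ℓB (proj₁ start)
  where
  open Window α β 1≤α 1≤β
  L B : ℕ
  L = ⌈log₂ n ⌉
  B = ceilDiv u ℓ * L
  -- G(L·u) ≥ 2^L ≥ n, so the least start index k exists and k ≤ L·u
  found : Σ ℕ λ k → IsStartIndex α β n k × k ≤ L * u
  found = least-start n (L * u) (≤-trans (n≤2^⌈log₂n⌉ n 1≤n) (G-powers L))
  k : ℕ
  k = proj₁ found
  start : IsStartIndex α β n k
  start = proj₁ (proj₂ found)
  k<α+ℓB : k < α + ℓ * B
  k<α+ℓB = begin-strict
    k                     ≤⟨ proj₂ (proj₂ found) ⟩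
    L * u                 ≤⟨ *-monoʳ-≤ L (ceilDiv-spec u ℓ 1≤ℓ) ⟩
    L * (ceilDiv u ℓ * ℓ) ≡⟨ budget-rearrange L (ceilDiv u ℓ) ℓ ⟩
    ℓ * B                 <⟨ m<n+m (ℓ * B) 1≤α ⟩
    α + ℓ * B             ∎
    where open ≤-Reasoning
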